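{- For a simple game $(N,\mathcal{W})$ on $n$ players, $\nu(N,\mathcal{W})=z_B(\{N\setminus S: S\in\mathcal{W}\},n)$.
   Context: A simple game $(N,\mathcal{W})$: $N$ a finite set with $|N|=n$, $\mathcal{W}$ a family of subsets (winning coalitions) with $\emptyset\notin\mathcal{W}$, $N\in\mathcal{W}$, closed under supersets. $\nu(N,\mathcal{W})$ is the minimum number of winning coalitions with empty intersection ($\infty$ if none). For a family $P$ of subsets of $N$ (identified with incidence vectors in $\{0,1\}^n$), $z_B(P,n)$ is the minimum of $\sum_{a\in P}x_a$ over $x\in\{0,1\}^{P}$ with $\sum_{a\in P}x_a a=\mathbf{1}$ (the all-ones vector), and $\infty$ if no such $x$ exists. Thus $\{N\setminus S:S\in\mathcal{W}\}$ corresponds to the vectors $\mathbf{1}-\chi_S$, $\chi_S$ the incidence vector of a winning coalition $S$. -}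

module Defs where

open import Data.Nat using (ℕ; _≤_; _+_)
open import Data.Bool using (Bool; true; false)
open import Data.Fin using (Fin)
open import Data.Fin.Subset using (Subset; _⊆_; _∩_; ∁; ⊤; ⊥)
open import Data.Vec using (lookup)
open import Data.List using (List; length; foldr; map)
open import Data.Nat.ListAction using (sum)
open import Data.List.Relation.Unary.All using (All)
open import Data.List.Relation.Unary.Unique.Propositional using (Unique)
open import Data.Product using (Σ; _×_; ∃)
open import Relation.Nullary using (¬_)
open import Relation.Binary.PropositionalEquality using (_≡_)

-- Players are Fin n; coalitions are subsets of Fin n, i.e. incidence vectors in {0,1}^n.

record SimpleGame (n : ℕ) : Set₁ where
  field
    W         : Subset n → Set
    ∅∉W       : ¬ W ⊥
    N∈W       : W ⊤
    superset  : ∀ {S T} → W S → S ⊆ T → W T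

data ℕ∞ : Set where
  fin : ℕ → ℕ∞
  ∞   : ℕ∞

IsMin : (ℕ → Set) → ℕ∞ → Set
IsMin Q (fin k) = Q k × (∀ j → Q j → k ≤ j)
IsMin Q ∞       = ∀ j → ¬ Q j

⋂ : ∀ {n} → List (Subset n) → Subset n
⋂ = foldr _∩_ ⊤

HasEmptyIntersectionFamily : ∀ {n} → SimpleGame n → ℕ → Set
HasEmptyIntersectionFamily {n} G k =
  Σ (List (Subset n)) λ Ss →
    Unique Ss × All (SimpleGame.W G) Ss × length Ss ≡ k × ⋂ Ss ≡ ⊥

IsNu : ∀ {n} → SimpleGame n → ℕ∞ → Set
IsNu G = IsMin (HasEmptyIntersectionFamily G)

coord : ∀ {n} → Subset n → Fin n → ℕ
coord a i with lookup a i
... | true  = 1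
... | false = 0

-- A 0/1 vector x ∈ {0,1}^P is represented by the list of distinct a ∈ P with x_a = 1;
-- ∑_a x_a a = 𝟏 means every coordinate of the sum equals 1; ∑_a x_a = length.
HasZBSolution : ∀ {n} → (P : Subset n → Set) → ℕ → Set
HasZBSolution {n} P k =
  Σ (List (Subset n)) λ xs →
    Unique xs × All P xs × length xs ≡ k ×
    (∀ (i : Fin n) → sum (map (λ a → coord a i) xs) ≡ 1)

IsZB : ∀ {n} → (Subset n → Set) → ℕ∞ → Set
IsZB P = IsMin (HasZBSolution P)

complements : ∀ {n} → SimpleGame n → Subset n → Set
complements G a = ∃ λ S → SimpleGame.W G S × a ≡ ∁ S

-- If winning coalitions S₁, …, S_k have empty intersection, the sets
-- S₁ᶜ, S₁ ∩ S₂ᶜ, S₁ ∩ S₂ ∩ S₃ᶜ, … partition N. The j-th one lies in S_jᶜ, so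
-- its complement contains S_j and is winning; the nonempty ones are distinct,
-- being disjoint, so they form an exact cover of size at most k. Conversely,
-- the complements of an exact cover by complements of winning coalitions are
-- winning coalitions with empty intersection. So each of the two minimised
-- quantities is bounded by the other.
module Submission where

open import Defs
open import Data.Nat using (ℕ; suc; _+_; _≤_)
open import Data.Nat.Properties using (≤-antisym; ≤-trans)
open import Data.Nat.ListAction using (sum)
open import Data.Fin using (Fin)
open import Data.Fin.Subset using (Subset; _∈_; _∉_; _⊆_; _∩_; ∁; ⊤; ⊥; Nonempty)
open import Data.Fin.Subset.Properties
  using (⊆-antisym; ⊆-trans; p∩q⊆p; p∩q⊆q; x∈p∩q⁺; x∈p∩q⁻; x∈∁p⇒x∉p; x∈p⇒x∉∁p; x∉p⇒x∈∁p; x∉∁p⇒x∈p; _∈?_; ∉⊥; ∈⊤; Empty-unique; nonempty?)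
open import Data.Vec using (lookup)
open import Data.Vec.Properties using ([]=⇒lookup; lookup⇒[]=)
open import Data.Bool using (true; false)
open import Data.List using (List; []; _∷_; length; map; filter)
open import Data.List.Properties using (length-map; length-filter)
open import Data.List.Relation.Unary.All using (All; []; _∷_)
import Data.List.Relation.Unary.All as All
import Data.List.Relation.Unary.All.Properties as All
open import Data.List.Relation.Unary.AllPairs using (AllPairs; []; _∷_)
import Data.List.Relation.Unary.AllPairs.Properties as AllPairs
open import Data.List.Relation.Unary.Unique.Propositional using (Unique)
import Data.List.Relation.Unary.Unique.Propositional.Properties as Unique
open import Data.Product using (Σ; _×_; _,_; proj₂)
open import Function.Base using (_∘_; case_of_)
open import Function.Bundles using (_⇔_; mk⇔)
open import Relation.Nullary using (yes; no; contradiction)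
open import Relation.Binary.PropositionalEquality using (_≡_; refl; sym; trans; cong; cong₂; subst)

IsMin-⇔ : {Q R : ℕ → Set} →
          (∀ k → R k → Q k) → (∀ k → Q k → Σ ℕ λ j → j ≤ k × R j) →
          ∀ v → IsMin Q v ⇔ IsMin R v
IsMin-⇔ {Q} {R} R⇒Q Q⇒R (fin k) = mk⇔ to from
  where
  to : IsMin Q (fin k) → IsMin R (fin k)
  to (qk , k-least) with Q⇒R k qk
  ... | j , j≤k , rj = subst R (≤-antisym j≤k (k-least j (R⇒Q j rj))) rj
                     , λ j rj → k-least j (R⇒Q j rj)
  from : IsMin R (fin k) → IsMin Q (fin k)
  from (rk , k-least) = R⇒Q k rk , λ j qj → let (i , i≤j , ri) = Q⇒R j qj in ≤-trans (k-least i ri) i≤j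
IsMin-⇔ R⇒Q Q⇒R ∞ = mk⇔ (λ none j rj → none j (R⇒Q j rj))
                         (λ none j qj → let (i , _ , ri) = Q⇒R j qj in none i ri)

module _ {n : ℕ} where

  ∁-involutive : (p : Subset n) → ∁ (∁ p) ≡ p
  ∁-involutive p = ⊆-antisym (x∉∁p⇒x∈p ∘ x∈∁p⇒x∉p) (x∉p⇒x∈∁p ∘ x∈p⇒x∉∁p)

  ∁-injective : {p q : Subset n} → ∁ p ≡ ∁ q → p ≡ q
  ∁-injective {p} {q} eq = trans (sym (∁-involutive p)) (trans (cong ∁ eq) (∁-involutive q))

  ∈⋂⁻ : ∀ {i} (Ss : List (Subset n)) → i ∈ ⋂ Ss → All (i ∈_) Ss
  ∈⋂⁻ []       _   = []
  ∈⋂⁻ (S ∷ Ss) i∈⋂ = let (i∈S , i∈⋂Ss) = x∈p∩q⁻ S (⋂ Ss) i∈⋂ in i∈S ∷ ∈⋂⁻ Ss i∈⋂Ss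

  coord-∈ : ∀ {a : Subset n} {i} → i ∈ a → coord a i ≡ 1
  coord-∈ i∈a rewrite []=⇒lookup i∈a = refl

  coord-∉ : ∀ {a : Subset n} {i} → i ∉ a → coord a i ≡ 0
  coord-∉ {a} {i} i∉a with lookup a i in eq
  ... | true  = contradiction (lookup⇒[]= i a eq) i∉a
  ... | false = refl

  x∈p∩∁q⇒x∉q : ∀ {i} {p q : Subset n} → i ∈ p ∩ ∁ q → i ∉ q
  x∈p∩∁q⇒x∉q {p = p} {q} = x∈∁p⇒x∉p ∘ proj₂ ∘ x∈p∩q⁻ p (∁ q)

  multiplicity : Fin n → List (Subset n) → ℕ
  multiplicity i as = sum (map (λ a → coord a i) as)

  multiplicity-∉ : ∀ {i} {as : List (Subset n)} → All (i ∉_) as → multiplicity i as ≡ 0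
  multiplicity-∉ []            = refl
  multiplicity-∉ (i∉a ∷ i∉as) = cong₂ _+_ (coord-∉ i∉a) (multiplicity-∉ i∉as)

  multiplicity-filter-nonempty : ∀ i (as : List (Subset n)) →
                                 multiplicity i (filter nonempty? as) ≡ multiplicity i as
  multiplicity-filter-nonempty i []       = refl
  multiplicity-filter-nonempty i (a ∷ as) with nonempty? a
  ... | yes _ = cong (coord a i +_) (multiplicity-filter-nonempty i as)
  ... | no  a-empty = trans (multiplicity-filter-nonempty i as)
                            (sym (cong (_+ multiplicity i as) (coord-∉ (λ i∈a → a-empty (i , i∈a)))))

  Disjoint : Subset n → Subset n → Set
  Disjoint p q = ∀ {i} → i ∈ p → i ∉ q

  disjoint-nonempty⇒unique : {as : List (Subset n)} →
                             AllPairs Disjoint as → All Nonempty as → Unique as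
  disjoint-nonempty⇒unique []                    []                 = []
  disjoint-nonempty⇒unique (a#as ∷ disjoint) ((i , i∈a) ∷ nonempty) =
    All.map (λ a#b a≡b → a#b i∈a (subst (i ∈_) a≡b i∈a)) a#as
    ∷ disjoint-nonempty⇒unique disjoint nonempty

  differences : Subset n → List (Subset n) → List (Subset n)
  differences R []       = []
  differences R (S ∷ Ss) = R ∩ ∁ S ∷ differences (R ∩ S) Ss

  length-differences : ∀ R (Ss : List (Subset n)) → length (differences R Ss) ≡ length Ss
  length-differences R []       = refl
  length-differences R (S ∷ Ss) = cong suc (length-differences (R ∩ S) Ss)

  differences-⊆ : ∀ R (Ss : List (Subset n)) → All (_⊆ R) (differences R Ss)
  differences-⊆ R []       = []
  differences-⊆ R (S ∷ Ss) = p∩q⊆p R (∁ S)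
                           ∷ All.map {P = _⊆ R ∩ S} {Q = _⊆ R} (λ D⊆R∩S → ⊆-trans D⊆R∩S (p∩q⊆p R S))
                                     (differences-⊆ (R ∩ S) Ss)

  differences-disjoint : ∀ R (Ss : List (Subset n)) → AllPairs Disjoint (differences R Ss)
  differences-disjoint R []       = []
  differences-disjoint R (S ∷ Ss) =
    All.map {P = _⊆ R ∩ S} {Q = Disjoint (R ∩ ∁ S)}
            (λ D⊆R∩S i∈R∖S i∈D → x∈p∩∁q⇒x∉q i∈R∖S (p∩q⊆q R S (D⊆R∩S i∈D)))
            (differences-⊆ (R ∩ S) Ss)
    ∷ differences-disjoint (R ∩ S) Ss

  -- Each i ∈ R ∖ ⋂ Ss lies in the piece for the first S ∌ i and in no other.
  multiplicity-differences : ∀ {i} R (Ss : List (Subset n)) → i ∈ R → i ∉ ⋂ Ss →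
                             multiplicity i (differences R Ss) ≡ 1
  multiplicity-differences R []       i∈R i∉⋂ = contradiction ∈⊤ i∉⋂
  multiplicity-differences {i} R (S ∷ Ss) i∈R i∉⋂ with i ∈? S
  ... | yes i∈S = cong₂ _+_ (coord-∉ {a = R ∩ ∁ S} λ i∈R∖S → x∈p∩∁q⇒x∉q i∈R∖S i∈S)
                            (multiplicity-differences (R ∩ S) Ss (x∈p∩q⁺ (i∈R , i∈S))
                                                      (λ i∈⋂Ss → i∉⋂ (x∈p∩q⁺ (i∈S , i∈⋂Ss))))
  ... | no  i∉S = cong₂ _+_ (coord-∈ (x∈p∩q⁺ (i∈R , x∉p⇒x∈∁p i∉S)))
                            (multiplicity-∉ (All.map {P = _⊆ R ∩ S} (λ D⊆R∩S i∈D → i∉S (p∩q⊆q R S (D⊆R∩S i∈D)))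
                                                     (differences-⊆ (R ∩ S) Ss)))

  exact-cover⇒⋂∁≡⊥ : {as : List (Subset n)} → (∀ i → multiplicity i as ≡ 1) → ⋂ (map ∁ as) ≡ ⊥
  exact-cover⇒⋂∁≡⊥ {as} cover = Empty-unique λ (i , i∈⋂) →
    let i∉as = All.map x∈∁p⇒x∉p (All.map⁻ (∈⋂⁻ (map ∁ as) i∈⋂)) in
    case trans (sym (cover i)) (multiplicity-∉ i∉as) of λ ()

module _ {n : ℕ} (G : SimpleGame n) where
  open SimpleGame G

  winning-∁⇒complements : {D : Subset n} → W (∁ D) → complements G D
  winning-∁⇒complements {D} w = ∁ D , w , sym (∁-involutive D)

  complements⇒winning-∁ : {D : Subset n} → complements G D → W (∁ D)
  complements⇒winning-∁ (S , w , refl) = subst W (sym (∁-involutive S)) w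

  differences-complements : ∀ R {Ss} → All W Ss → All (complements G) (differences R Ss)
  differences-complements R []                 = []
  differences-complements R {S ∷ Ss} (w ∷ ws) =
    winning-∁⇒complements (superset w λ i∈S → x∉p⇒x∈∁p λ i∈R∖S → x∈p∩∁q⇒x∉q i∈R∖S i∈S)
    ∷ differences-complements (R ∩ S) ws

  nu⇒zB : ∀ k → HasEmptyIntersectionFamily G k → Σ ℕ λ j → j ≤ k × HasZBSolution (complements G) j
  nu⇒zB k (Ss , _ , ws , refl , ⋂≡⊥) =
    length pieces ,
    subst (length pieces ≤_) (length-differences ⊤ Ss) (length-filter nonempty? (differences ⊤ Ss)) ,
    pieces , unique , All.filter⁺ nonempty? (differences-complements ⊤ ws) , refl , cover
    where
    pieces : List (Subset n)
    pieces = filter nonempty? (differences ⊤ Ss)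
    unique : Unique pieces
    unique = disjoint-nonempty⇒unique (AllPairs.filter⁺ nonempty? (differences-disjoint ⊤ Ss))
                                      (All.all-filter nonempty? (differences ⊤ Ss))
    cover : ∀ i → multiplicity i pieces ≡ 1
    cover i = trans (multiplicity-filter-nonempty i (differences ⊤ Ss))
                    (multiplicity-differences ⊤ Ss ∈⊤ (subst (i ∉_) (sym ⋂≡⊥) ∉⊥))

  zB⇒nu : ∀ k → HasZBSolution (complements G) k → HasEmptyIntersectionFamily G k
  zB⇒nu k (as , unique , cs , |as|≡k , cover) =
    map ∁ as , Unique.map⁺ ∁-injective unique , All.map⁺ (All.map complements⇒winning-∁ cs) ,
    trans (length-map ∁ as) |as|≡k , exact-cover⇒⋂∁≡⊥ {as = as} cover

proposition9 : ∀ (n : ℕ) (G : SimpleGame n) (v : ℕ∞) →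
    IsNu G v ⇔ IsZB (complements G) v
proposition9 n G = IsMin-⇔ (zB⇒nu G) (nu⇒zB G)
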